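{- Let $k\ge 2$, $\Delta\ge 2$ be integers. The independent set model has uniqueness on $\mathbb{T}_{k,\Delta}$ if and only if $\limsup_{n\to\infty}|p_{n+1}-p_n|=0$.
   Context: $\mathbb{T}_{k,\Delta}$ is the infinite $(\Delta-1)$-ary $k$-uniform hypertree with root $\rho$: recursively, each vertex has $\Delta-1$ "descending" hyperedges, each consisting of that vertex together with $k-1$ new vertices. Level $0$ is $\{\rho\}$ and the new vertices in descending hyperedges of level-$i$ vertices form level $i+1$. For $n\ge 0$, $\mathbb{T}_{k,\Delta}(n)$ is the sub-hypergraph induced by levels $0,\dots,n$ (vertex set $V_n$), and $L_n$ is the set of level-$n$ vertices (the leaves). An independent set of a hypergraph is a vertex subset containing no hyperedge; identify it with $\sigma:V_n\to\{0,1\}$ ($\sigma(v)=1$ iff $v$ is in the set). $\mu_n$ is the uniform distribution on independent sets of $\mathbb{T}_{k,\Delta}(n)$. The independent set model has uniqueness on $\mathbb{T}_{k,\Delta}$ iff $\limsup_{n\to\infty}\max_{\eta,\eta':L_n\to\{0,1\}}\big|\mu_n(\sigma_\rho=1\mid\sigma_{L_n}=\eta)-\mu_n(\sigma_\rho=1\mid\sigma_{L_n}=\eta')\big|=0$, where $\sigma_\rho$ is the spin of the root and $\sigma_{L_n}$ the restriction to $L_n$. Finally $p_n:=\mu_n(\sigma_\rho=1\mid\sigma_{L_n}\equiv 1)$. -}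

module Defs where

open import Data.Nat using (ℕ; zero; suc; _∸_) renaming (_≤_ to _≤ℕ_)
open import Data.Bool using (Bool; true; false; _∧_; not; if_then_else_)
open import Data.Fin using (Fin; zero; suc)
open import Data.List using (List; []; _∷_; [_]; map; concatMap; allFin)
open import Data.Product using (_×_; _,_)
open import Data.Integer using (+_)
open import Data.Rational using (ℚ; 0ℚ; _/_; _-_; ∣_∣; _≤_; _<_)
open import Data.Product using (∃-syntax)

all : {X : Set} → (X → Bool) → List X → Bool
all p [] = true
all p (x ∷ xs) = p x ∧ all p xs

_==_ : Bool → Bool → Bool
true  == b = b
false == b = not b

allFuns : {X : Set} → List X → (m : ℕ) → List (Fin m → X)
allFuns xs zero = [ (λ ()) ]
allFuns xs (suc m) =
  concatMap (λ x → map (λ f → λ { zero → x ; (suc i) → f i }) (allFuns xs m)) xs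

count : {X : Set} → (X → Bool) → List X → ℕ
count p [] = 0
count p (x ∷ xs) = if p x then suc (count p xs) else count p xs

-- a / b as a rational (b is never 0 where used; the 0 case is a dummy)
frac : ℕ → ℕ → ℚ
frac a zero = 0ℚ
frac a (suc b) = (+ a) / suc b

-- A vertex of level i is addressed by a
-- sequence of i steps (j , c) : Fin (Δ-1) × Fin (k-1): the j-th descending
-- hyperedge, and the c-th new vertex in it.  A spin configuration
-- σ : V_n → {0,1} is stored as a tree: the spin of the root together with,
-- for each (j , c), the configuration on the subtree below that child.
module Hypertree (k Δ : ℕ) where

  a b : ℕ
  a = Δ ∸ 1
  b = k ∸ 1

  Config : ℕ → Set
  Config zero = Bool
  Config (suc n) = Bool × (Fin a → Fin b → Config n)

  LeafConfig : ℕ → Set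
  LeafConfig zero = Bool
  LeafConfig (suc n) = Fin a → Fin b → LeafConfig n

  rootSpin : ∀ {n} → Config n → Bool
  rootSpin {zero} s = s
  rootSpin {suc n} (r , _) = r

  -- σ contains no hyperedge.  The hyperedges of T(n) are, for each vertex v
  -- of level < n and each j, the set {v} ∪ {child (j , c) of v | c}.
  independent : ∀ n → Config n → Bool
  independent zero s = true
  independent (suc n) (r , ch) =
    all (λ j → not (r ∧ all (λ c → rootSpin (ch j c)) (allFin b))) (allFin a)
    ∧ all (λ j → all (λ c → independent n (ch j c)) (allFin b)) (allFin a)

  agreesOnLeaves : ∀ n → Config n → LeafConfig n → Bool
  agreesOnLeaves zero s η = s == η
  agreesOnLeaves (suc n) (r , ch) η =
    all (λ j → all (λ c → agreesOnLeaves n (ch j c) (η j c)) (allFin b)) (allFin a)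

  allConfigs : ∀ n → List (Config n)
  allConfigs zero = true ∷ false ∷ []
  allConfigs (suc n) =
    concatMap (λ r → map (λ ch → (r , ch)) (allFuns (allFuns (allConfigs n) b) a))
              (true ∷ false ∷ [])

  condRootProb : ∀ n → LeafConfig n → ℚ
  condRootProb n η =
    frac (count (λ σ → independent n σ ∧ agreesOnLeaves n σ η ∧ rootSpin σ) (allConfigs n))
         (count (λ σ → independent n σ ∧ agreesOnLeaves n σ η) (allConfigs n))

  allOnes : ∀ n → LeafConfig n
  allOnes zero = true
  allOnes (suc n) = λ _ _ → allOnes n

  p : ℕ → ℚ
  p n = condRootProb n (allOnes n)

  -- limsup_n max_{η,η'} |μ_n(..|η) − μ_n(..|η')| = 0  (quantities are ≥ 0)
  Uniqueness : Set
  Uniqueness =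
    ∀ (ε : ℚ) → 0ℚ < ε → ∃[ N ] ∀ n → N ≤ℕ n →
      ∀ (η η′ : LeafConfig n) → ∣ condRootProb n η - condRootProb n η′ ∣ ≤ ε

  LimsupPDiffZero : Set
  LimsupPDiffZero =
    ∀ (ε : ℚ) → 0ℚ < ε → ∃[ N ] ∀ n → N ≤ℕ n → ∣ p (suc n) - p n ∣ ≤ ε

-- Write Z_n(η) and T_n(η) for the numbers of independent sets of T_{k,Δ}(n) that
-- agree with η on the leaves, with the root occupied and in total, so that
-- μ_n(σ_ρ = 1 | η) = Z_n(η) / T_n(η).  Splitting at the root, whose spin is
-- constrained only through its descending hyperedges, gives
--   Z_{n+1} = ∏_j W_j,  W_j = ∏_c T_c − ∏_c Z_c,   T_{n+1} = Z_{n+1} + ∏_j ∏_c T_c,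
-- over the children c of the hyperedges j.  This recursion is antitone in every
-- ratio Z_c / T_c, so by induction the all-zeros and all-ones boundary conditions
-- are extremal at every depth (in alternating order), and every difference
-- |μ_n(· | η) − μ_n(· | η′)| is bounded by theirs.  Finally, occupied leaves at
-- depth n+1 force every vertex of depth n to be empty, so the all-ones condition at
-- depth n+1 is the all-zeros condition at depth n, and that extremal difference
-- is exactly |p_{n+1} − p_n|.
module Submission where

open import Defs
open import Data.Bool using (Bool; true; false; _∧_; not; if_then_else_)
open import Data.Bool.Properties
  using (∧-assoc; ∧-comm; ∧-identityʳ; ∧-zeroʳ; ∧-commutativeMonoid)
open import Data.Fin using (Fin; zero; suc)
import Data.Integer as ℤ
import Data.Integer.Properties as ℤ
open import Data.List using (List; []; _∷_; map; concatMap; allFin; tabulate; _++_)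
open import Data.Nat using (ℕ; zero; suc; _+_; _*_; _≤_; z≤n; s≤s)
open import Data.Nat.Properties
open import Data.Product using (_×_; _,_; proj₁; proj₂)
open import Data.Rational using (ℚ; _-_; -_; ∣_∣) renaming (_≤_ to _≤ℚ_)
import Data.Rational.Properties as ℚ
import Data.Rational.Unnormalised as ℚᵘ
import Data.Rational.Unnormalised.Properties as ℚᵘ
open import Data.Sum using (_⊎_; inj₁; inj₂)
open import Function using (_∘_; id)
open import Function.Bundles using (_⇔_; mk⇔)
open import Relation.Binary.PropositionalEquality

open import Algebra.Properties.CommutativeSemigroup *-commutativeSemigroup
  using (interchange)
open import Algebra.Properties.Group ℚ.+-0-group using (⁻¹-anti-homo-//)

open import Algebra.Properties.CommutativeMonoid.Sum ∧-commutativeMonoid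
  using () renaming (sum to ⋀; sum-cong-≗ to ⋀-cong; ∑-distrib-+ to ⋀-distrib-∧)
open import Algebra.Properties.CommutativeMonoid.Sum *-1-commutativeMonoid
  using () renaming (sum to ∏; sum-cong-≗ to ∏-cong; sum-replicate-zero to ∏-replicate-1)

all-tabulate : ∀ {X : Set} m (p : X → Bool) (f : Fin m → X) →
  all p (tabulate f) ≡ ⋀ (p ∘ f)
all-tabulate zero    p f = refl
all-tabulate (suc m) p f = cong (p (f zero) ∧_) (all-tabulate m p (f ∘ suc))

all-allFin : ∀ m (p : Fin m → Bool) → all p (allFin m) ≡ ⋀ p
all-allFin m p = all-tabulate m p id

count-cong : ∀ {X : Set} {p q : X → Bool} → (∀ x → p x ≡ q x) →
  ∀ l → count p l ≡ count q l
count-cong         p≗q []      = refl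
count-cong {q = q} p≗q (x ∷ l) rewrite p≗q x with q x
... | true  = cong suc (count-cong p≗q l)
... | false = count-cong p≗q l

count-++ : ∀ {X : Set} (p : X → Bool) (l l′ : List X) →
  count p (l ++ l′) ≡ count p l + count p l′
count-++ p []      l′ = refl
count-++ p (x ∷ l) l′ with p x
... | true  = cong suc (count-++ p l l′)
... | false = count-++ p l l′

count-map : ∀ {X Y : Set} (p : Y → Bool) (f : X → Y) (l : List X) →
  count p (map f l) ≡ count (p ∘ f) l
count-map p f []      = refl
count-map p f (x ∷ l) with p (f x)
... | true  = cong suc (count-map p f l)
... | false = count-map p f l

count-false : ∀ {X : Set} (l : List X) → count (λ _ → false) l ≡ 0
count-false []      = refl
count-false (x ∷ l) = count-false l

count-partition : ∀ {X : Set} (e g : X → Bool) (l : List X) →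
  count (λ x → not (e x) ∧ g x) l + count (λ x → e x ∧ g x) l ≡ count g l
count-partition e g []      = refl
count-partition e g (x ∷ l) with e x | g x
... | true  | true  = trans (+-suc _ _) (cong suc (count-partition e g l))
... | true  | false = count-partition e g l
... | false | true  = cong suc (count-partition e g l)
... | false | false = count-partition e g l

count-concatMap : ∀ {X Y : Set} {q : Y → Bool} (p : X → Bool) (K : ℕ) (G : X → List Y) →
  (∀ x → count q (G x) ≡ (if p x then K else 0)) →
  ∀ xs → count q (concatMap G xs) ≡ count p xs * K
count-concatMap         p K G block []       = refl
count-concatMap {q = q} p K G block (x ∷ xs) = begin
  count q (G x ++ concatMap G xs)            ≡⟨ count-++ q (G x) _ ⟩
  count q (G x) + count q (concatMap G xs)   ≡⟨ cong₂ _+_ (block x) (count-concatMap p K G block xs) ⟩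
  (if p x then K else 0) + count p xs * K    ≡⟨ add-block (p x) ⟩
  count p (x ∷ xs) * K                       ∎
  where
  open ≡-Reasoning
  add-block : ∀ c → (if c then K else 0) + count p xs * K
                  ≡ (if c then suc (count p xs) else count p xs) * K
  add-block true  = refl
  add-block false = refl

count-allFuns : ∀ {X : Set} (xs : List X) m (P : Fin m → X → Bool) →
  count (λ f → ⋀ (λ i → P i (f i))) (allFuns xs m) ≡ ∏ (λ i → count (P i) xs)
count-allFuns xs zero    P = refl
count-allFuns xs (suc m) P = count-concatMap (P zero) _ _ block xs
  where
  K = ∏ (λ i → count (P (suc i)) xs)
  guarded : ∀ c → count (λ f → c ∧ ⋀ (λ i → P (suc i) (f i))) (allFuns xs m)
                ≡ (if c then K else 0)
  guarded true  = count-allFuns xs m (P ∘ suc)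
  guarded false = count-false (allFuns xs m)
  block : ∀ x → count (λ f → ⋀ (λ i → P i (f i))) (map _ (allFuns xs m))
              ≡ (if P zero x then K else 0)
  block x = trans (count-map _ _ (allFuns xs m)) (guarded (P zero x))

infix 4 _/_≼_/_

data _/_≼_/_ (x y u v : ℕ) : Set where
  *≤* : x * v ≤ u * y → x / y ≼ u / v

drop-*≤* : ∀ {x y u v} → x / y ≼ u / v → x * v ≤ u * y
drop-*≤* (*≤* x*v≤u*y) = x*v≤u*y

∏-mono-≼ : ∀ m {x y u v : Fin m → ℕ} → (∀ i → x i / y i ≼ u i / v i) →
  ∏ x / ∏ y ≼ ∏ u / ∏ v
∏-mono-≼ zero    h = *≤* ≤-refl
∏-mono-≼ (suc m) {x} {y} {u} {v} h = *≤* (begin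
  (x zero * X) * (v zero * V) ≡⟨ interchange (x zero) X (v zero) V ⟩
  (x zero * v zero) * (X * V) ≤⟨ *-mono-≤ (drop-*≤* (h zero)) (drop-*≤* (∏-mono-≼ m (h ∘ suc))) ⟩
  (u zero * y zero) * (U * Y) ≡⟨ interchange (u zero) (y zero) U Y ⟩
  (u zero * U) * (y zero * Y) ∎)
  where
  open ≤-Reasoning
  X = ∏ (x ∘ suc)
  Y = ∏ (y ∘ suc)
  U = ∏ (u ∘ suc)
  V = ∏ (v ∘ suc)

≼-complement : ∀ {z t z′ t′ w w′} → w + z ≡ t → w′ + z′ ≡ t′ →
  z / t ≼ z′ / t′ → w′ / t′ ≼ w / t
≼-complement {z} {t} {z′} {t′} {w} {w′} w+z≡t w′+z′≡t′ (*≤* zt′≤z′t) =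
  *≤* (+-cancelʳ-≤ (z′ * t) (w′ * t) (w * t′) (begin
    w′ * t + z′ * t  ≡⟨ sym (*-distribʳ-+ t w′ z′) ⟩
    (w′ + z′) * t    ≡⟨ cong (_* t) w′+z′≡t′ ⟩
    t′ * t           ≡⟨ *-comm t′ t ⟩
    t * t′           ≡⟨ cong (_* t′) (sym w+z≡t) ⟩
    (w + z) * t′     ≡⟨ *-distribʳ-+ t′ w z ⟩
    w * t′ + z * t′  ≤⟨ +-monoʳ-≤ (w * t′) zt′≤z′t ⟩
    w * t′ + z′ * t  ∎))
  where open ≤-Reasoning

x/y≼u/v⇒x/x+y≼u/u+v : ∀ {x y u v} → x / y ≼ u / v → x / x + y ≼ u / u + v
x/y≼u/v⇒x/x+y≼u/u+v {x} {y} {u} {v} (*≤* xv≤uy) = *≤* (begin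
  x * (u + v)    ≡⟨ *-distribˡ-+ x u v ⟩
  x * u + x * v  ≤⟨ +-monoʳ-≤ (x * u) xv≤uy ⟩
  x * u + u * y  ≡⟨ cong (_+ u * y) (*-comm x u) ⟩
  u * x + u * y  ≡⟨ sym (*-distribˡ-+ u x y) ⟩
  u * (x + y)    ∎)
  where open ≤-Reasoning

∏-pos : ∀ m (f : Fin m → ℕ) → (∀ i → 1 ≤ f i) → 1 ≤ ∏ f
∏-pos zero    f pos = ≤-refl
∏-pos (suc m) f pos = *-mono-≤ (pos zero) (∏-pos m (f ∘ suc) (pos ∘ suc))

∏-zero : ∀ m (f : Fin m → ℕ) (i : Fin m) → f i ≡ 0 → ∏ f ≡ 0
∏-zero (suc m) f zero    fi≡0 = cong (_* ∏ (f ∘ suc)) fi≡0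
∏-zero (suc m) f (suc i) fi≡0 = trans (cong (f zero *_) (∏-zero m (f ∘ suc) i fi≡0)) (*-zeroʳ (f zero))

frac-mono : ∀ {x y u v} → 1 ≤ y → 1 ≤ v → x / y ≼ u / v → frac x y ≤ℚ frac u v
frac-mono {x} {suc y} {u} {suc v} _ _ (*≤* xv≤uy) =
  ℚ.toℚᵘ-cancel-≤
    (ℚᵘ.≤-respˡ-≃ (ℚᵘ.≃-sym (ℚ.toℚᵘ-fromℚᵘ (ℚᵘ.mkℚᵘ (ℤ.+ x) y)))
      (ℚᵘ.≤-respʳ-≃ (ℚᵘ.≃-sym (ℚ.toℚᵘ-fromℚᵘ (ℚᵘ.mkℚᵘ (ℤ.+ u) v)))
        (ℚᵘ.*≤* (subst₂ ℤ._≤_ (ℤ.pos-* x (suc v)) (ℤ.pos-* u (suc y)) (ℤ.+≤+ xv≤uy)))))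

∣p-q∣≡∣q-p∣ : ∀ p q → ∣ p - q ∣ ≡ ∣ q - p ∣
∣p-q∣≡∣q-p∣ p q = trans (sym (ℚ.∣-p∣≡∣p∣ (p - q))) (cong ∣_∣ (⁻¹-anti-homo-// p q))

∣-∣-≤-between : ∀ {u v x y} → u ≤ℚ x → x ≤ℚ v → u ≤ℚ y → y ≤ℚ v → ∣ x - y ∣ ≤ℚ ∣ u - v ∣
∣-∣-≤-between {u} {v} {x} {y} u≤x x≤v u≤y y≤v =
  subst (∣ x - y ∣ ≤ℚ_) (trans (sym ∣v-u∣≡v-u) (∣p-q∣≡∣q-p∣ v u)) ∣x-y∣≤v-u
  where
  ∣v-u∣≡v-u : ∣ v - u ∣ ≡ v - u
  ∣v-u∣≡v-u = ℚ.0≤p⇒∣p∣≡p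
    (subst (_≤ℚ v - u) (ℚ.+-inverseʳ u) (ℚ.+-monoˡ-≤ (- u) (ℚ.≤-trans u≤x x≤v)))
  ∣x-y∣≤v-u : ∣ x - y ∣ ≤ℚ v - u
  ∣x-y∣≤v-u with ℚ.∣p∣≡p∨∣p∣≡-p (x - y)
  ... | inj₁ ∣x-y∣≡x-y  = subst (_≤ℚ v - u) (sym ∣x-y∣≡x-y)
                            (ℚ.+-mono-≤ x≤v (ℚ.neg-antimono-≤ u≤y))
  ... | inj₂ ∣x-y∣≡y-x = subst (_≤ℚ v - u) (sym (trans ∣x-y∣≡y-x (⁻¹-anti-homo-// x y)))
                            (ℚ.+-mono-≤ y≤v (ℚ.neg-antimono-≤ u≤x))

module Counting (k Δ : ℕ) where

  open Hypertree k Δ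

  admissible : ∀ n → LeafConfig n → Config n → Bool
  admissible n η σ = independent n σ ∧ agreesOnLeaves n σ η

  -- occupied is spelled as in condRootProb, which is then frac (occupied n η) (total n η)
  -- by definition
  occupied total : ∀ n → LeafConfig n → ℕ
  occupied n η = count (λ σ → independent n σ ∧ agreesOnLeaves n σ η ∧ rootSpin σ) (allConfigs n)
  total    n η = count (admissible n η) (allConfigs n)

  EdgeConfig : ℕ → Set
  EdgeConfig n = Fin b → Config n

  edgeConfigs : ∀ n → List (EdgeConfig n)
  edgeConfigs n = allFuns (allConfigs n) b

  saturated : ∀ {n} → EdgeConfig n → Bool
  saturated g = ⋀ (rootSpin ∘ g)

  compatible : ∀ n → (Fin b → LeafConfig n) → EdgeConfig n → Bool
  compatible n ηs g = ⋀ (λ c → admissible n (ηs c) (g c))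

  unsaturated : ∀ n → (Fin b → LeafConfig n) → ℕ
  unsaturated n ηs = count (λ g → not (saturated g) ∧ compatible n ηs g) (edgeConfigs n)

  compatible-count : ∀ n ηs → count (compatible n ηs) (edgeConfigs n) ≡ ∏ (total n ∘ ηs)
  compatible-count n ηs = count-allFuns (allConfigs n) b (admissible n ∘ ηs)

  saturated-count : ∀ n ηs →
    count (λ g → saturated g ∧ compatible n ηs g) (edgeConfigs n) ≡ ∏ (occupied n ∘ ηs)
  saturated-count n ηs = begin
    count (λ g → saturated g ∧ compatible n ηs g) (edgeConfigs n)
      ≡⟨ count-cong (λ g → sym (⋀-distrib-∧ (rootSpin ∘ g) (λ c → admissible n (ηs c) (g c))))
                    (edgeConfigs n) ⟩
    count (λ g → ⋀ (λ c → rootSpin (g c) ∧ admissible n (ηs c) (g c))) (edgeConfigs n)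
      ≡⟨ count-allFuns (allConfigs n) b (λ c σ → rootSpin σ ∧ admissible n (ηs c) σ) ⟩
    ∏ (λ c → count (λ σ → rootSpin σ ∧ admissible n (ηs c) σ) (allConfigs n))
      ≡⟨ ∏-cong (λ c → count-cong (λ σ → root-last (rootSpin σ) (independent n σ) (agreesOnLeaves n σ (ηs c)))
                                  (allConfigs n)) ⟩
    ∏ (occupied n ∘ ηs) ∎
    where
    open ≡-Reasoning
    root-last : ∀ r i a → r ∧ (i ∧ a) ≡ i ∧ (a ∧ r)
    root-last r i a = trans (∧-comm r (i ∧ a)) (∧-assoc i a r)

  unsaturated-complement : ∀ n ηs →
    unsaturated n ηs + ∏ (occupied n ∘ ηs) ≡ ∏ (total n ∘ ηs)
  unsaturated-complement n ηs =
    trans (cong (unsaturated n ηs +_) (sym (saturated-count n ηs)))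
      (trans (count-partition saturated (compatible n ηs) (edgeConfigs n))
        (compatible-count n ηs))

  children : ∀ n → List (Fin a → EdgeConfig n)
  children n = allFuns (edgeConfigs n) a

  count-allConfigs-suc : ∀ n (q : Config (suc n) → Bool) →
    count q (allConfigs (suc n))
      ≡ count (λ ch → q (true , ch)) (children n) + count (λ ch → q (false , ch)) (children n)
  count-allConfigs-suc n q =
    trans (count-++ q (map (true ,_) (children n)) _)
      (cong₂ _+_ (count-map q _ (children n))
        (trans (count-++ q (map (false ,_) (children n)) [])
          (trans (+-identityʳ _) (count-map q _ (children n)))))

  admissible-suc : ∀ n η r ch → admissible (suc n) η (r , ch)
    ≡ ⋀ (λ j → not (r ∧ saturated (ch j)) ∧ compatible n (η j) (ch j))
  admissible-suc n η r ch = begin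
    (all hyperedge (allFin a) ∧ nested indep) ∧ nested agree
      ≡⟨ cong₂ _∧_ (cong₂ _∧_ hyperedges (nested-⋀ indep)) (nested-⋀ agree) ⟩
    (⋀ open-edge ∧ ⋀ (⋀ ∘ indep)) ∧ ⋀ (⋀ ∘ agree)
      ≡⟨ ∧-assoc (⋀ open-edge) _ _ ⟩
    ⋀ open-edge ∧ (⋀ (⋀ ∘ indep) ∧ ⋀ (⋀ ∘ agree))
      ≡⟨ cong (⋀ open-edge ∧_)
              (trans (sym (⋀-distrib-∧ (⋀ ∘ indep) (⋀ ∘ agree)))
                     (⋀-cong (λ j → sym (⋀-distrib-∧ (indep j) (agree j))))) ⟩
    ⋀ open-edge ∧ ⋀ (λ j → compatible n (η j) (ch j))
      ≡⟨ sym (⋀-distrib-∧ open-edge (λ j → compatible n (η j) (ch j))) ⟩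
    ⋀ (λ j → open-edge j ∧ compatible n (η j) (ch j)) ∎
    where
    open ≡-Reasoning
    hyperedge open-edge : Fin a → Bool
    hyperedge j = not (r ∧ all (λ c → rootSpin (ch j c)) (allFin b))
    open-edge j = not (r ∧ saturated (ch j))
    indep agree : Fin a → Fin b → Bool
    indep j c = independent n (ch j c)
    agree j c = agreesOnLeaves n (ch j c) (η j c)
    nested : (Fin a → Fin b → Bool) → Bool
    nested P = all (λ j → all (P j) (allFin b)) (allFin a)
    nested-⋀ : ∀ P → nested P ≡ ⋀ (⋀ ∘ P)
    nested-⋀ P = trans (all-allFin a _) (⋀-cong (λ j → all-allFin b (P j)))
    hyperedges : all hyperedge (allFin a) ≡ ⋀ open-edge
    hyperedges = trans (all-allFin a hyperedge)
      (⋀-cong (λ j → cong (λ s → not (r ∧ s)) (all-allFin b (rootSpin ∘ ch j))))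


  occupied-suc : ∀ n η → occupied (suc n) η ≡ ∏ (λ j → unsaturated n (η j))
  occupied-suc n η = begin
    occupied (suc n) η
      ≡⟨ count-allConfigs-suc n _ ⟩
    count (λ ch → independent (suc n) (true , ch) ∧ (agreesOnLeaves (suc n) (true , ch) η ∧ true))
            (children n)
      + count (λ ch → independent (suc n) (false , ch) ∧ (agreesOnLeaves (suc n) (false , ch) η ∧ false))
              (children n)
      ≡⟨ cong₂ _+_ (count-cong (λ ch → cong (independent (suc n) (true , ch) ∧_) (∧-identityʳ _)) (children n))
                   (trans (count-cong (λ ch → trans (cong (independent (suc n) (false , ch) ∧_) (∧-zeroʳ _))
                                                          (∧-zeroʳ _)) (children n))
                          (count-false (children n))) ⟩
    count (λ ch → admissible (suc n) η (true , ch)) (children n) + 0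
      ≡⟨ +-identityʳ _ ⟩
    count (λ ch → admissible (suc n) η (true , ch)) (children n)
      ≡⟨ count-cong (admissible-suc n η true) (children n) ⟩
    count (λ ch → ⋀ (λ j → not (saturated (ch j)) ∧ compatible n (η j) (ch j))) (children n)
      ≡⟨ count-allFuns (edgeConfigs n) a (λ j g → not (saturated g) ∧ compatible n (η j) g) ⟩
    ∏ (λ j → unsaturated n (η j)) ∎
    where open ≡-Reasoning

  total-suc : ∀ n η → total (suc n) η ≡ occupied (suc n) η + ∏ (λ j → ∏ (total n ∘ η j))
  total-suc n η = begin
    total (suc n) η
      ≡⟨ count-allConfigs-suc n _ ⟩
    count (λ ch → admissible (suc n) η (true , ch)) (children n)
      + count (λ ch → admissible (suc n) η (false , ch)) (children n)
      ≡⟨ cong₂ _+_ (count-cong (admissible-suc n η true) (children n))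
                   (count-cong (admissible-suc n η false) (children n)) ⟩
    count (λ ch → ⋀ (λ j → not (saturated (ch j)) ∧ compatible n (η j) (ch j))) (children n)
      + count (λ ch → ⋀ (λ j → compatible n (η j) (ch j))) (children n)
      ≡⟨ cong₂ _+_ (count-allFuns (edgeConfigs n) a (λ j g → not (saturated g) ∧ compatible n (η j) g))
                   (count-allFuns (edgeConfigs n) a (compatible n ∘ η)) ⟩
    ∏ (λ j → unsaturated n (η j)) + ∏ (λ j → count (compatible n (η j)) (edgeConfigs n))
      ≡⟨ cong₂ _+_ (sym (occupied-suc n η)) (∏-cong (compatible-count n ∘ η)) ⟩
    occupied (suc n) η + ∏ (λ j → ∏ (total n ∘ η j)) ∎
    where open ≡-Reasoning

  total-pos : ∀ n η → 1 ≤ total n η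
  total-pos zero    true  = ≤-refl
  total-pos zero    false = ≤-refl
  total-pos (suc n) η rewrite total-suc n η =
    ≤-trans (∏-pos a _ (λ j → ∏-pos b _ (λ c → total-pos n (η j c)))) (m≤n+m _ _)

  ProbLe : ∀ n → LeafConfig n → LeafConfig n → Set
  ProbLe n η η′ = occupied n η / total n η ≼ occupied n η′ / total n η′

  ProbLe-antitone : ∀ n {η η′ : LeafConfig (suc n)} →
    (∀ j c → ProbLe n (η j c) (η′ j c)) → ProbLe (suc n) η′ η
  ProbLe-antitone n {η} {η′} children≼
    rewrite total-suc n η | total-suc n η′ | occupied-suc n η | occupied-suc n η′ =
    x/y≼u/v⇒x/x+y≼u/u+v (∏-mono-≼ a (λ j →
      ≼-complement (unsaturated-complement n (η j)) (unsaturated-complement n (η′ j))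
        (∏-mono-≼ b (children≼ j))))

  condRootProb-mono : ∀ n {η η′} → ProbLe n η η′ → condRootProb n η ≤ℚ condRootProb n η′
  condRootProb-mono n {η} {η′} = frac-mono (total-pos n η) (total-pos n η′)

  zeros : ∀ n → LeafConfig n
  zeros zero    = false
  zeros (suc n) = λ _ _ → zeros n

  Extremal : ∀ n → LeafConfig n → LeafConfig n → Set
  Extremal n lo hi = ∀ η → ProbLe n lo η × ProbLe n η hi

  Extremal-suc : ∀ n {lo hi} → Extremal n lo hi → Extremal (suc n) (λ _ _ → hi) (λ _ _ → lo)
  Extremal-suc n ext η =
    ProbLe-antitone n (λ j c → proj₂ (ext (η j c))) ,
    ProbLe-antitone n (λ j c → proj₁ (ext (η j c)))

  boundary-extremal : ∀ n → Extremal n (zeros n) (allOnes n) ⊎ Extremal n (allOnes n) (zeros n)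
  boundary-extremal zero = inj₁ λ where
    true  → *≤* z≤n , *≤* (s≤s z≤n)
    false → *≤* z≤n , *≤* z≤n
  boundary-extremal (suc n) with boundary-extremal n
  ... | inj₁ ext = inj₂ (Extremal-suc n ext)
  ... | inj₂ ext = inj₁ (Extremal-suc n ext)

  Extremal-spread : ∀ n {lo hi} → Extremal n lo hi → ∀ η η′ →
    ∣ condRootProb n η - condRootProb n η′ ∣ ≤ℚ ∣ condRootProb n lo - condRootProb n hi ∣
  Extremal-spread n ext η η′ =
    ∣-∣-≤-between (mono (proj₁ (ext η))) (mono (proj₂ (ext η)))
                  (mono (proj₁ (ext η′))) (mono (proj₂ (ext η′)))
    where mono = condRootProb-mono n

  condRootProb-spread : ∀ n η η′ →
    ∣ condRootProb n η - condRootProb n η′ ∣ ≤ℚ ∣ condRootProb n (zeros n) - condRootProb n (allOnes n) ∣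
  condRootProb-spread n η η′ with boundary-extremal n
  ... | inj₁ ext = Extremal-spread n ext η η′
  ... | inj₂ ext = subst (∣ condRootProb n η - condRootProb n η′ ∣ ≤ℚ_)
                     (∣p-q∣≡∣q-p∣ (condRootProb n (allOnes n)) (condRootProb n (zeros n)))
                     (Extremal-spread n ext η η′)

  counts-suc-cong : ∀ {m n} (η : LeafConfig (suc m)) (η′ : LeafConfig (suc n)) →
    (∀ j c → occupied m (η j c) ≡ occupied n (η′ j c)) →
    (∀ j c → total m (η j c) ≡ total n (η′ j c)) →
    occupied (suc m) η ≡ occupied (suc n) η′ × total (suc m) η ≡ total (suc n) η′
  counts-suc-cong {m} {n} η η′ occ tot = occ-suc , (begin
    total (suc m) η                                     ≡⟨ total-suc m η ⟩
    occupied (suc m) η + ∏ (λ j → ∏ (total m ∘ η j))     ≡⟨ cong₂ _+_ occ-suc (∏-cong (∏-cong ∘ tot)) ⟩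
    occupied (suc n) η′ + ∏ (λ j → ∏ (total n ∘ η′ j))  ≡⟨ sym (total-suc n η′) ⟩
    total (suc n) η′                                    ∎)
    where
    open ≡-Reasoning
    unsat : ∀ j → unsaturated m (η j) ≡ unsaturated n (η′ j)
    unsat j = +-cancelʳ-≡ _ _ _ (begin
      unsaturated m (η j) + ∏ (occupied m ∘ η j)    ≡⟨ unsaturated-complement m (η j) ⟩
      ∏ (total m ∘ η j)                             ≡⟨ ∏-cong (tot j) ⟩
      ∏ (total n ∘ η′ j)                            ≡⟨ sym (unsaturated-complement n (η′ j)) ⟩
      unsaturated n (η′ j) + ∏ (occupied n ∘ η′ j)  ≡⟨ cong (_ +_) (∏-cong (sym ∘ occ j)) ⟩
      unsaturated n (η′ j) + ∏ (occupied m ∘ η j)   ∎)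
    occ-suc : occupied (suc m) η ≡ occupied (suc n) η′
    occ-suc = trans (occupied-suc m η) (trans (∏-cong unsat) (sym (occupied-suc n η′)))

  allOnes-suc : Fin a → ∀ n →
    occupied (suc n) (allOnes (suc n)) ≡ occupied n (zeros n) ×
    total (suc n) (allOnes (suc n)) ≡ total n (zeros n)
  allOnes-suc j₀ zero = occ-one , (begin
    total 1 (allOnes 1)
      ≡⟨ total-suc 0 (allOnes 1) ⟩
    occupied 1 (allOnes 1) + ∏ {a} (λ _ → ∏ {b} (λ _ → 1))
      ≡⟨ cong₂ _+_ occ-one (∏-cong {a} (λ _ → ∏-replicate-1 b)) ⟩
    0 + ∏ {a} (λ _ → 1)
      ≡⟨ ∏-replicate-1 a ⟩
    1 ∎)
    where
    open ≡-Reasoning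
    -- every hyperedge below the root consists of occupied leaves, so it is saturated
    unsat-zero : unsaturated 0 (λ _ → true) ≡ 0
    unsat-zero = +-cancelʳ-≡ _ _ 0 (unsaturated-complement 0 (λ _ → true))
    occ-one : occupied 1 (allOnes 1) ≡ 0
    occ-one = trans (occupied-suc 0 (allOnes 1)) (∏-zero a _ j₀ unsat-zero)
  allOnes-suc j₀ (suc n) =
    counts-suc-cong (allOnes (suc (suc n))) (zeros (suc n))
      (λ _ _ → proj₁ (allOnes-suc j₀ n)) (λ _ _ → proj₂ (allOnes-suc j₀ n))

  p-suc : Fin a → ∀ n → p (suc n) ≡ condRootProb n (zeros n)
  p-suc j₀ n = cong₂ frac (proj₁ (allOnes-suc j₀ n)) (proj₂ (allOnes-suc j₀ n))

lemma55 : (k Δ : ℕ) → 2 ≤ k → 2 ≤ Δ →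
    Hypertree.Uniqueness k Δ ⇔ Hypertree.LimsupPDiffZero k Δ
lemma55 k Δ@(suc (suc _)) _ (s≤s (s≤s _)) = mk⇔ uniqueness⇒limsup limsup⇒uniqueness
  where
  open Hypertree k Δ
  open Counting k Δ

  gap : ∀ n → ∣ condRootProb n (zeros n) - condRootProb n (allOnes n) ∣ ≡ ∣ p (suc n) - p n ∣
  gap n = cong (λ q → ∣ q - p n ∣) (sym (p-suc zero n))

  uniqueness⇒limsup : Uniqueness → LimsupPDiffZero
  uniqueness⇒limsup uniq ε ε>0 with uniq ε ε>0
  ... | N , bound = N , λ n N≤n → subst (_≤ℚ ε) (gap n) (bound n N≤n (zeros n) (allOnes n))

  limsup⇒uniqueness : LimsupPDiffZero → Uniqueness
  limsup⇒uniqueness lim ε ε>0 with lim ε ε>0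
  ... | N , bound = N , λ n N≤n η η′ →
    ℚ.≤-trans (subst (∣ condRootProb n η - condRootProb n η′ ∣ ≤ℚ_) (gap n)
                     (condRootProb-spread n η η′))
              (bound n N≤n)
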